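{- There are no fully-transitive 3-orbit maniplexes; that is, if $\mathcal{M}$ is an $(n-1)$-maniplex whose automorphism group has exactly 3 orbits on flags, then there is some $i\in\{0,\dots,n-1\}$ such that $\mathrm{Aut}(\mathcal{M})$ is not transitive on the $i$-faces of $\mathcal{M}$.
   Context: An $(n-1)$-maniplex is given by a connected simple graph (flag graph), whose vertices are called flags, with a proper edge-colouring by colours $\{0,\dots,n-1\}$, each colour class a perfect matching, such that for colours $i,j$ with $|i-j|\ge2$ each component of the subgraph spanned by colours $i,j$ is a 4-cycle. Automorphisms are colour-preserving graph automorphisms. An $i$-face is a connected component of the flag graph with the $i$-edges removed. A maniplex is fully-transitive if its automorphism group is transitive on $i$-faces for every $i\in\{0,\dots,n-1\}$. -}

module Defs where

open import Data.Nat using (ℕ; _+_; _≤_)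
open import Data.Fin using (Fin; toℕ)
open import Data.List using (List; []; _∷_; foldr)
open import Data.List.Relation.Unary.All using (All)
open import Data.Product using (Σ; ∃; _×_)
open import Relation.Binary.PropositionalEquality using (_≡_; _≢_)
open import Relation.Nullary using (¬_)

FarApart : {n : ℕ} → Fin n → Fin n → Set
FarApart i j = (toℕ i + 2 ≤ toℕ j) Data.Sum.⊎ (toℕ j + 2 ≤ toℕ i)
  where import Data.Sum

-- An (n-1)-maniplex, presented by its flag graph.  Since every colour class
-- is a perfect matching, the i-edges are encoded by the i-adjacency map
-- r i : Flag → Flag (a fixed-point-free involution).
record Maniplex (n : ℕ) : Set₁ where
  field
    Flag : Set
    r : Fin n → Flag → Flag
    r-invol : ∀ i x → r i (r i x) ≡ x
    r-fpf : ∀ i x → r i x ≢ x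
    r-simple : ∀ i j x → i ≢ j → r i x ≢ r j x
    -- for |i-j| ≥ 2 each {i,j}-component is a 4-cycle
    -- (x, r i x, r j (r i x) = r i (r j x), r j x)
    r-comm : ∀ i j x → FarApart i j → r i (r j x) ≡ r j (r i x)

  walk : List (Fin n) → Flag → Flag
  walk w x = foldr r x w

  field
    connected : ∀ x y → ∃ λ (w : List (Fin n)) → walk w x ≡ y

  SameFace : Fin n → Flag → Flag → Set
  SameFace i x y = ∃ λ (w : List (Fin n)) → All (λ j → j ≢ i) w × walk w x ≡ y

open Maniplex public

record Aut {n : ℕ} (M : Maniplex n) : Set where
  field
    fun : Flag M → Flag M
    inv : Flag M → Flag M
    inv-left : ∀ x → inv (fun x) ≡ x
    inv-right : ∀ x → fun (inv x) ≡ x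
    preserves : ∀ i x → fun (r M i x) ≡ r M i (fun x)

open Aut public

SameOrbit : {n : ℕ} (M : Maniplex n) → Flag M → Flag M → Set
SameOrbit M x y = ∃ λ (φ : Aut M) → fun φ x ≡ y

ThreeOrbit : {n : ℕ} → Maniplex n → Set
ThreeOrbit M =
  Σ (Flag M) λ a → Σ (Flag M) λ b → Σ (Flag M) λ c →
    ¬ SameOrbit M a b × ¬ SameOrbit M a c × ¬ SameOrbit M b c ×
    (∀ x → SameOrbit M a x Data.Sum.⊎ (SameOrbit M b x Data.Sum.⊎ SameOrbit M c x))
  where import Data.Sum

-- Aut(M) is transitive on i-faces: for the i-faces F ∋ x and G ∋ y there is
-- an automorphism φ with φ(F) = G, i.e. φ x lies in the i-face of y
-- (automorphisms map i-faces onto i-faces).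
FaceTransitive : {n : ℕ} (M : Maniplex n) → Fin n → Set
FaceTransitive M i = ∀ x y → ∃ λ (φ : Aut M) → SameFace M i (fun φ x) y

FullyTransitive : {n : ℕ} → Maniplex n → Set
FullyTransitive {n} M = ∀ (i : Fin n) → FaceTransitive M i

module Submission where

open import Defs
open import Data.Nat using (ℕ)
open import Relation.Nullary using (¬_)

open import Algebra.Definitions using (Involutive)
open import Data.Fin using (Fin; zero; suc)
open import Data.Fin.Properties using (all?; any?; _≟_; punchInᵢ≢i)
open import Data.Nat using (suc; s≤s; z≤n)
open import Data.List using ([]; _∷_)
open import Data.List.Relation.Unary.All using (All; []; _∷_)
open import Data.Product using (∃; ∃₂; _×_; _,_; proj₁; proj₂)
import Data.Sum as Sum
open import Data.Vec using (_∷_; []; lookup)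
open import Data.Vec.Properties using (lookup∘tabulate)
open import Function using (_∘_)
open import Relation.Binary.PropositionalEquality
open import Relation.Nullary using (Dec; yes; no; contradiction)
open import Relation.Nullary.Decidable using (¬?; _×-dec_; _→-dec_; from-yes)

-- Proof idea: the generators r i act on the three flag orbits by involutions σ i, and
-- σ i, σ j commute when |i - j| ≥ 2.  Let m be the least colour with σ m ≠ id; being a
-- non-trivial involution of a 3-element set, σ m has exactly one fixed orbit p, and every
-- σ j commuting with σ m preserves it.  So all σ j with j ≠ m + 1 fix p: an (m+1)-face
-- through a flag of orbit p contains only flags of orbit p, hence cannot be mapped by an
-- automorphism onto an (m+1)-face through a flag of another orbit.

IsUniqueFixedPoint : {A : Set} → (A → A) → A → Set
IsUniqueFixedPoint f p = f p ≡ p × (∀ q → f q ≡ q → q ≡ p)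

NontrivialInvolution⇒UniqueFixedPoint : {A : Set} → (A → A) → Set
NontrivialInvolution⇒UniqueFixedPoint f =
  Involutive _≡_ f → ¬ (∀ k → f k ≡ k) → ∃ (IsUniqueFixedPoint f)

nontrivialInvolution⇒uniqueFixedPoint-resp-≗ :
  {A : Set} {f g : A → A} → f ≗ g →
  NontrivialInvolution⇒UniqueFixedPoint f → NontrivialInvolution⇒UniqueFixedPoint g
nontrivialInvolution⇒uniqueFixedPoint-resp-≗ {f = f} {g} f≗g claim g-inv g≢id
  with claim f-inv (g≢id ∘ f≡id⇒g≡id)
  where
  open ≡-Reasoning
  f-inv : Involutive _≡_ f
  f-inv k = begin
    f (f k) ≡⟨ cong f (f≗g k) ⟩
    f (g k) ≡⟨ f≗g (g k) ⟩
    g (g k) ≡⟨ g-inv k ⟩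
    k       ∎
  f≡id⇒g≡id : (∀ k → f k ≡ k) → ∀ k → g k ≡ k
  f≡id⇒g≡id f≡id k = trans (sym (f≗g k)) (f≡id k)
... | p , fp≡p , unique = p , trans (sym (f≗g p)) fp≡p , λ q gq≡q → unique q (trans (f≗g q) gq≡q)

nontrivialInvolution⇒uniqueFixedPoint? :
  (f : Fin 3 → Fin 3) → Dec (NontrivialInvolution⇒UniqueFixedPoint f)
nontrivialInvolution⇒uniqueFixedPoint? f =
  all? (λ k → f (f k) ≟ k) →-dec (¬? (all? λ k → f k ≟ k) →-dec
    any? λ p → (f p ≟ p) ×-dec all? λ q → (f q ≟ q) →-dec (q ≟ p))

-- Checked exhaustively on the 27 maps Fin 3 → Fin 3, presented as lookup tables; opaque so
-- that the check is not re-run by unfolding at use sites.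
opaque
  nontrivialInvolution⇒uniqueFixedPoint :
    (f : Fin 3 → Fin 3) → NontrivialInvolution⇒UniqueFixedPoint f
  nontrivialInvolution⇒uniqueFixedPoint f =
    nontrivialInvolution⇒uniqueFixedPoint-resp-≗ (lookup∘tabulate f)
      (table (f zero) (f (suc zero)) (f (suc (suc zero))))
    where
    table : ∀ a b c → NontrivialInvolution⇒UniqueFixedPoint (lookup (a ∷ b ∷ c ∷ []))
    table = from-yes (all? λ a → all? λ b → all? λ c →
      nontrivialInvolution⇒uniqueFixedPoint? (lookup (a ∷ b ∷ c ∷ [])))

FarCommuting : {n : ℕ} {A : Set} → (Fin n → A → A) → Set
FarCommuting σ = ∀ i j k → FarApart i j → σ i (σ j k) ≡ σ j (σ i k)

commonFixedPointOffOneColour :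
  {n : ℕ} (σ : Fin (suc n) → Fin 3 → Fin 3) →
  (∀ i → Involutive _≡_ (σ i)) → FarCommuting σ →
  ∃₂ λ i p → ∀ j → j ≢ i → σ j p ≡ p
commonFixedPointOffOneColour {ℕ.zero} σ _ _ = zero , zero , λ { zero 0≢0 → contradiction refl 0≢0 }
commonFixedPointOffOneColour {suc n} σ σ-inv σ-comm with all? (λ k → σ zero k ≟ k)
... | yes σ₀≡id with commonFixedPointOffOneColour (σ ∘ suc) (σ-inv ∘ suc)
                       (λ i j k → σ-comm (suc i) (suc j) k ∘ Sum.map s≤s s≤s)
...   | i , p , fixed = suc i , p , λ { zero _ → σ₀≡id p ; (suc j) j≢i → fixed j (j≢i ∘ cong suc) }
commonFixedPointOffOneColour {suc n} σ σ-inv σ-comm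
    | no σ₀≢id with nontrivialInvolution⇒uniqueFixedPoint (σ zero) (σ-inv zero) σ₀≢id
...   | p , σ₀p≡p , unique = suc zero , p , fixed
  where
  fixed : ∀ j → j ≢ suc zero → σ j p ≡ p
  fixed zero _ = σ₀p≡p
  fixed (suc zero) 1≢1 = contradiction refl 1≢1
  fixed j@(suc (suc _)) _ = unique (σ j p)
    (trans (σ-comm zero j p (Sum.inj₁ (s≤s (s≤s z≤n)))) (cong (σ j) σ₀p≡p))

module _ {n : ℕ} {M : Maniplex n} where

  idᴬ : Aut M
  idᴬ = record
    { fun = λ x → x ; inv = λ x → x
    ; inv-left = λ _ → refl ; inv-right = λ _ → refl ; preserves = λ _ _ → refl }

  _∘ᴬ_ : Aut M → Aut M → Aut M
  φ ∘ᴬ ψ = record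
    { fun = fun φ ∘ fun ψ
    ; inv = inv ψ ∘ inv φ
    ; inv-left = λ x → trans (cong (inv ψ) (inv-left φ (fun ψ x))) (inv-left ψ x)
    ; inv-right = λ x → trans (cong (fun φ) (inv-right ψ (inv φ x))) (inv-right φ x)
    ; preserves = λ i x → trans (cong (fun φ) (preserves ψ i x)) (preserves φ i (fun ψ x))
    }

  _⁻¹ᴬ : Aut M → Aut M
  φ ⁻¹ᴬ = record
    { fun = inv φ ; inv = fun φ
    ; inv-left = inv-right φ ; inv-right = inv-left φ
    ; preserves = λ i x → begin
        inv φ (r M i x)                 ≡⟨ cong (inv φ ∘ r M i) (inv-right φ x) ⟨
        inv φ (r M i (fun φ (inv φ x))) ≡⟨ cong (inv φ) (preserves φ i (inv φ x)) ⟨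
        inv φ (fun φ (r M i (inv φ x))) ≡⟨ inv-left φ _ ⟩
        r M i (inv φ x)                 ∎
    }
    where open ≡-Reasoning

  SameOrbit-sym : ∀ {x y} → SameOrbit M x y → SameOrbit M y x
  SameOrbit-sym {x} (φ , φx≡y) = φ ⁻¹ᴬ , trans (cong (inv φ) (sym φx≡y)) (inv-left φ x)

  SameOrbit-trans : ∀ {x y z} → SameOrbit M x y → SameOrbit M y z → SameOrbit M x z
  SameOrbit-trans (φ , φx≡y) (ψ , ψy≡z) = ψ ∘ᴬ φ , trans (cong (fun ψ) φx≡y) ψy≡z

record OrbitLabelling {n : ℕ} (M : Maniplex n) (K : Set) : Set where
  field
    rep : K → Flag M
    label : Flag M → K
    rep-label : ∀ x → SameOrbit M (rep (label x)) x
    rep-injective : ∀ {k l} → SameOrbit M (rep k) (rep l) → k ≡ l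

  label-rep : ∀ k → label (rep k) ≡ k
  label-rep k = rep-injective (rep-label (rep k))

  label-resp-SameOrbit : ∀ {x y} → SameOrbit M x y → label x ≡ label y
  label-resp-SameOrbit {x} {y} x∼y = rep-injective
    (SameOrbit-trans (SameOrbit-trans (rep-label x) x∼y) (SameOrbit-sym (rep-label y)))

  σ : Fin n → K → K
  σ i k = label (r M i (rep k))

  label-r : ∀ i x → label (r M i x) ≡ σ i (label x)
  label-r i x with rep-label x
  ... | φ , φx₀≡x = sym (label-resp-SameOrbit (φ , trans (preserves φ i _) (cong (r M i) φx₀≡x)))

  σ-involutive : ∀ i → Involutive _≡_ (σ i)
  σ-involutive i k = begin
    σ i (σ i k)                   ≡⟨ label-r i (r M i (rep k)) ⟨
    label (r M i (r M i (rep k))) ≡⟨ cong label (r-invol M i (rep k)) ⟩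
    label (rep k)                 ≡⟨ label-rep k ⟩
    k                             ∎
    where open ≡-Reasoning

  σ-farCommuting : FarCommuting σ
  σ-farCommuting i j k i⋯j = begin
    σ i (σ j k)                   ≡⟨ label-r i (r M j (rep k)) ⟨
    label (r M i (r M j (rep k))) ≡⟨ cong label (r-comm M i j (rep k) i⋯j) ⟩
    label (r M j (r M i (rep k))) ≡⟨ label-r j (r M i (rep k)) ⟩
    σ j (σ i k)                   ∎
    where open ≡-Reasoning

  label-walk : ∀ {i p} → (∀ j → j ≢ i → σ j p ≡ p) →
               ∀ {w} x → All (_≢ i) w → label x ≡ p → label (walk M w x) ≡ p
  label-walk fixed x [] lx≡p = lx≡p
  label-walk {p = p} fixed {j ∷ w} x (j≢i ∷ w≢i) lx≡p = begin
    label (r M j (walk M w x)) ≡⟨ label-r j (walk M w x) ⟩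
    σ j (label (walk M w x))   ≡⟨ cong (σ j) (label-walk fixed x w≢i lx≡p) ⟩
    σ j p                      ≡⟨ fixed j j≢i ⟩
    p                          ∎
    where open ≡-Reasoning

  ¬faceTransitive : ∀ {i p q} → q ≢ p → (∀ j → j ≢ i → σ j p ≡ p) → ¬ FaceTransitive M i
  ¬faceTransitive {i} {p} {q} q≢p fixed faceTransitive with faceTransitive (rep p) (rep q)
  ... | φ , w , w≢i , walk≡ = q≢p (begin
    q                                  ≡⟨ label-rep q ⟨
    label (rep q)                      ≡⟨ cong label walk≡ ⟨
    label (walk M w (fun φ (rep p)))   ≡⟨ label-walk fixed _ w≢i φp-label ⟩
    p                                  ∎)
    where
    open ≡-Reasoning
    φp-label : label (fun φ (rep p)) ≡ p
    φp-label = trans (sym (label-resp-SameOrbit (φ , refl))) (label-rep p)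

threeOrbit⇒orbitLabelling : {n : ℕ} {M : Maniplex n} → ThreeOrbit M → OrbitLabelling M (Fin 3)
threeOrbit⇒orbitLabelling {M = M} (a , b , c , a≁b , a≁c , b≁c , cover) = record
  { rep = rep ; label = label ; rep-label = rep-label ; rep-injective = rep-injective }
  where
  rep : Fin 3 → Flag M
  rep zero = a
  rep (suc zero) = b
  rep (suc (suc zero)) = c

  labelled : ∀ x → ∃ λ k → SameOrbit M (rep k) x
  labelled x with cover x
  ... | Sum.inj₁ a∼x = zero , a∼x
  ... | Sum.inj₂ (Sum.inj₁ b∼x) = suc zero , b∼x
  ... | Sum.inj₂ (Sum.inj₂ c∼x) = suc (suc zero) , c∼x

  label : Flag M → Fin 3
  label x = proj₁ (labelled x)

  rep-label : ∀ x → SameOrbit M (rep (label x)) x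
  rep-label x = proj₂ (labelled x)

  rep-injective : ∀ {k l} → SameOrbit M (rep k) (rep l) → k ≡ l
  rep-injective {zero} {zero} _ = refl
  rep-injective {zero} {suc zero} a∼b = contradiction a∼b a≁b
  rep-injective {zero} {suc (suc zero)} a∼c = contradiction a∼c a≁c
  rep-injective {suc zero} {zero} b∼a = contradiction (SameOrbit-sym b∼a) a≁b
  rep-injective {suc zero} {suc zero} _ = refl
  rep-injective {suc zero} {suc (suc zero)} b∼c = contradiction b∼c b≁c
  rep-injective {suc (suc zero)} {zero} c∼a = contradiction (SameOrbit-sym c∼a) a≁c
  rep-injective {suc (suc zero)} {suc zero} c∼b = contradiction (SameOrbit-sym c∼b) b≁c
  rep-injective {suc (suc zero)} {suc (suc zero)} _ = refl

noColours⇒singleFlag : (M : Maniplex 0) → ∀ x y → x ≡ y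
noColours⇒singleFlag M x y with connected M x y
... | [] , x≡y = x≡y

theorem4p3 : ∀ {n : ℕ} (M : Maniplex n) → ThreeOrbit M → ¬ FullyTransitive M
theorem4p3 {ℕ.zero} M (a , b , _ , a≁b , _) _ = a≁b (idᴬ , noColours⇒singleFlag M a b)
theorem4p3 {suc n} M threeOrbit fullyTransitive =
  let i , p , fixed = commonFixedPointOffOneColour σ σ-involutive σ-farCommuting
  in ¬faceTransitive (punchInᵢ≢i p zero) fixed (fullyTransitive i)
  where open OrbitLabelling (threeOrbit⇒orbitLabelling threeOrbit)
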